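{- Let $n\ge2$ and let $B=(b_{i,j})_{0\le i,j\le n-1}$ be an integer matrix with zero diagonal such that vertex $0$ is a sink, i.e. $b_{0,j}\le 0$ and $b_{j,0}\ge0$ for all $j$. Then $B$ has period 1 if and only if the following hold: (1) for $i=1,\dots,n-1$, $b_{0,i}$ and $b_{0,n-i}$ are either both negative or both zero; (2) $b_{i,0}=-b_{0,n-i}$ for $i=1,\dots,n-1$; (3) $b_{i,j}=b_{0,j-i}$ whenever $0<i<j\le n-1$, and $b_{i,j}=-b_{0,n-i+j}$ whenever $0<j<i\le n-1$.
   Context: An $n\times n$ integer matrix $B=(b_{i,j})$ with zeros on the diagonal (rows and columns indexed $0,\dots,n-1$) is the B-matrix of a double quiver; it encodes the binomial seed with exchange polynomials $P_i=\prod_{j:b_{i,j}>0}x_j^{b_{i,j}}+\prod_{j:b_{i,j}<0}x_j^{ -b_{i,j}}$. Vertex $0$ is mutable if $b_{j,0}\neq0$ implies $b_{0,j}\neq0$ for every $j$. The mutation of $B$ at $0$ is the matrix $\tilde B$ with $\tilde b_{i,j}=-b_{i,j}$ if $i=0$ or $j=0$, and $\tilde b_{i,j}=b_{i,j}+b_{i,0}\,|b_{0,j}|\,\mathbf{1}_{\{b_{0,i}b_{0,j}<0\}}$ otherwise. $B$ has period 1 if vertex $0$ is mutable and mutating at $0$ followed by relabeling vertices $i\mapsto i-1 \pmod n$ returns $B$, i.e. $\tilde b_{i+1,j+1}=b_{i,j}$ for $0\le i,j\le n-2$, $\tilde b_{0,i+1}=b_{n-1,i}$ and $\tilde b_{i+1,0}=b_{i,n-1}$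 for $0\le i\le n-2$. -}

module Defs where

open import Data.Nat as ℕ using (ℕ; zero; suc)
open import Data.Nat.DivMod using (_mod_)
open import Data.Fin using (Fin; zero; suc; toℕ)
open import Data.Integer using (ℤ; +_; -_; _+_; _*_; _<_; _≤_; ∣_∣; 0ℤ)
open import Data.Integer.Properties using (_<?_)
open import Data.Product using (_×_)
open import Relation.Nullary using (¬_; yes; no)
open import Relation.Binary.PropositionalEquality using (_≡_)

Matrix : ℕ → Set
Matrix n = Fin n → Fin n → ℤ

ZeroDiagonal : ∀ {n} → Matrix n → Set
ZeroDiagonal {n} B = ∀ (i : Fin n) → B i i ≡ 0ℤ

Mutable0 : ∀ {n} → Matrix (suc n) → Set
Mutable0 {n} B = ∀ (j : Fin (suc n)) → ¬ (B j zero ≡ 0ℤ) → ¬ (B zero j ≡ 0ℤ)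

Sink0 : ∀ {n} → Matrix (suc n) → Set
Sink0 {n} B = ∀ (j : Fin (suc n)) → (B zero j ≤ 0ℤ) × (0ℤ ≤ B j zero)

indNeg : ℤ → ℤ
indNeg x with x <? 0ℤ
... | yes _ = + 1
... | no  _ = 0ℤ

mutate0 : ∀ {n} → Matrix (suc n) → Matrix (suc n)
mutate0 B zero j = - B zero j
mutate0 B (suc i) zero = - B (suc i) zero
mutate0 B (suc i) (suc j) =
  B (suc i) (suc j)
    + B (suc i) zero * (+ ∣ B zero (suc j) ∣) * indNeg (B zero (suc i) * B zero (suc j))

-- relabeling i ↦ i+1 (mod n)  (the inverse direction of i ↦ i-1)
succMod : ∀ {n} → Fin (suc n) → Fin (suc n)
succMod {n} i = suc (toℕ i) mod (suc n)

-- For i = j = n-1 this reads b̃_{0,0} = b_{n-1,n-1}, which holds automatically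
-- for zero-diagonal B (both sides are 0); the other cases are exactly the
-- paper's three families of equations.
Period1 : ∀ {n} → Matrix (suc n) → Set
Period1 {n} B = Mutable0 B × (∀ (i j : Fin (suc n)) → mutate0 B (succMod i) (succMod j) ≡ B i j)

-- Because vertex 0 is a sink, all products b₀ᵢ b₀ⱼ are ≥ 0, so mutation at 0 only negates row and
-- column 0. Period 1 therefore says that B is invariant under the diagonal shift (i, j) ↦ (i+1, j+1)
-- away from the last row and column, while the wrap-around into row and column 0 costs a sign. Such
-- a matrix is skew-circulant: bᵢⱼ = b₀ₖ if i + k = j and bᵢⱼ = −b₀ₖ if i + k = n + j, which is
-- conditions (2) and (3). Given (2), mutability of 0 says b₀ᵢ = 0 exactly when b₀,ₙ₋ᵢ = 0, which for a
-- sink is condition (1).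
module Submission where

open import Defs
open import Data.Nat as ℕ using (ℕ; suc; _∸_)
open import Data.Fin using (Fin; zero; toℕ)
open import Data.Integer using (ℤ; -_; 0ℤ)
open import Data.Product using (_×_)
open import Data.Sum using (_⊎_)
open import Function.Bundles using (_⇔_)
open import Relation.Binary.PropositionalEquality using (_≡_)

open import Data.Nat using (zero; _+_; _≤_; _<_; z<s; s≤s; _≤?_)
open import Data.Nat.Properties
  using (<⇒≤; ≤-<-trans; m∸n≤m; <-irrefl; m<n⇒m<1+n; n<1+n; +-suc; +-assoc; +-comm; +-identityʳ; +-cancelˡ-<; +-cancelˡ-≡;
         +-monoʳ-<; m<m+n; m+[n∸m]≡n; m+n∸m≡n; m∸n+n≡m; +-∸-comm; suc-injective; ≰⇒>)
open import Data.Nat.DivMod using (m<n⇒m%n≡m; n%n≡0)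
open import Data.Fin using (suc; fromℕ; fromℕ<; inject₁)
open import Data.Fin.Properties using (toℕ-injective; toℕ-fromℕ<; toℕ-fromℕ; toℕ-inject₁; inject₁ℕ<; toℕ<n; toℕ≤n)
open import Data.Fin.Relation.Unary.Top using (View; view; ‵fromℕ; ‵inj₁)
import Data.Integer as ℤ using (_≤_; _*_; +_)
import Data.Integer.Properties as ℤ
open import Data.Integer using (+0; +[1+_]; -[1+_]; +≤+; ∣_∣)
open import Data.Product using (_,_; proj₁; ∃)
open import Data.Sum using (inj₁; inj₂)
open import Data.Empty using (⊥-elim)
open import Function.Base using (flip)
open import Function.Bundles using (mk⇔; module Equivalence)
open import Relation.Nullary using (¬_; yes; no)
open import Relation.Binary.PropositionalEquality using (refl; sym; trans; cong; cong₂; subst; subst₂; module ≡-Reasoning)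

open Equivalence using (to; from)

+≡+⇒≡∸+ : ∀ {m n o k} → o ≤ m → o + k ≡ m + n → k ≡ m ∸ o + n
+≡+⇒≡∸+ {m} {n} {o} {k} o≤m e = begin
  k            ≡⟨ sym (m+n∸m≡n o k) ⟩
  o + k ∸ o    ≡⟨ cong (_∸ o) e ⟩
  m + n ∸ o    ≡⟨ +-∸-comm n o≤m ⟩
  m ∸ o + n    ∎
  where open ≡-Reasoning

≡∸+⇒+≡+ : ∀ {m n o k} → o ≤ m → k ≡ m ∸ o + n → o + k ≡ m + n
≡∸+⇒+≡+ {m} {n} {o} o≤m refl = trans (sym (+-assoc o (m ∸ o) n)) (cong (_+ n) (m+[n∸m]≡n o≤m))

≡∸⇒+≡ : ∀ {a b k} → a ≤ b → k ≡ b ∸ a → a + k ≡ b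
≡∸⇒+≡ {a} a≤b refl = m+[n∸m]≡n a≤b

+≡+⇒> : ∀ {m n o k} → o + k ≡ m + n → k < m → n < o
+≡+⇒> {m} {n} {o} {k} e k<m = +-cancelˡ-< m n o (begin-strict
  m + n   ≡⟨ sym e ⟩
  o + k   <⟨ +-monoʳ-< o k<m ⟩
  o + m   ≡⟨ +-comm o m ⟩
  m + o   ∎)
  where open Data.Nat.Properties.≤-Reasoning

difference : ∀ {m a b} → a ≤ b → b < m → ∃ λ (k : Fin m) → a + toℕ k ≡ b
difference {a = a} {b} a≤b b<m =
  fromℕ< (≤-<-trans (m∸n≤m b a) b<m) , trans (cong (a +_) (toℕ-fromℕ< _)) (m+[n∸m]≡n a≤b)

wrappedDifference : ∀ {m a b} → b < a → a ≤ m → ∃ λ (k : Fin m) → a + toℕ k ≡ m + b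
wrappedDifference {m} {a} {b} b<a a≤m =
  fromℕ< bound , ≡∸+⇒+≡+ a≤m (toℕ-fromℕ< bound)
  where
  bound : m ∸ a + b < m
  bound = subst (m ∸ a + b <_) (m∸n+n≡m a≤m) (+-monoʳ-< (m ∸ a) b<a)

module _ {a} {A : Set a} {n : ℕ} where

  DiagonallyInvariant : (Fin (suc n) → Fin (suc n) → A) → Set a
  DiagonallyInvariant M = ∀ (i j : Fin n) → M (suc i) (suc j) ≡ M (inject₁ i) (inject₁ j)

  UpperToeplitz : (Fin (suc n) → Fin (suc n) → A) → Set a
  UpperToeplitz M = ∀ {i j k} → toℕ i + toℕ k ≡ toℕ j → M i j ≡ M zero k

  diagonallyInvariant-flip : ∀ {M} → DiagonallyInvariant M → DiagonallyInvariant (flip M)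
  diagonallyInvariant-flip inv i j = inv j i

  diagonallyInvariant⇒upperToeplitz : ∀ {M} → DiagonallyInvariant M → UpperToeplitz M
  diagonallyInvariant⇒upperToeplitz {M} inv {i} {j} {k} = descend (toℕ i) refl
    where
    descend : ∀ d {i j} → toℕ i ≡ d → d + toℕ k ≡ toℕ j → M i j ≡ M zero k
    descend zero    {zero}   {j}      _ e = cong (M zero) (toℕ-injective (sym e))
    descend (suc d) {suc i} {suc j} p e = trans (inv i j)
      (descend d (trans (toℕ-inject₁ i) (suc-injective p)) (trans (suc-injective e) (sym (toℕ-inject₁ j))))

indNeg-nonpos* : ∀ {x y} → x ℤ.≤ 0ℤ → y ℤ.≤ 0ℤ → indNeg (x ℤ.* y) ≡ 0ℤ
indNeg-nonpos* {+0}                    _        _        = refl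
indNeg-nonpos* { -[1+ a ] } {+0}        _        _        = cong indNeg (ℤ.*-zeroʳ -[1+ a ])
indNeg-nonpos* { -[1+ _ ] } { -[1+ _ ] } _        _        = refl
indNeg-nonpos* {+[1+ _ ]}              (+≤+ ()) _
indNeg-nonpos* { -[1+ _ ] } {+[1+ _ ]}  _        (+≤+ ())

succMod-inject₁ : ∀ {n} (i : Fin n) → succMod (inject₁ i) ≡ suc i
succMod-inject₁ {n} i = toℕ-injective (begin
  toℕ (succMod (inject₁ i))     ≡⟨ toℕ-fromℕ< _ ⟩
  suc (toℕ (inject₁ i)) ℕ.% suc n ≡⟨ m<n⇒m%n≡m (s≤s (inject₁ℕ< i)) ⟩
  suc (toℕ (inject₁ i))          ≡⟨ cong suc (toℕ-inject₁ i) ⟩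
  toℕ (suc i)                    ∎)
  where open ≡-Reasoning

succMod-fromℕ : ∀ n → succMod (fromℕ n) ≡ zero
succMod-fromℕ n = toℕ-injective (begin
  toℕ (succMod (fromℕ n))     ≡⟨ toℕ-fromℕ< _ ⟩
  suc (toℕ (fromℕ n)) ℕ.% suc n ≡⟨ cong (λ x → suc x ℕ.% suc n) (toℕ-fromℕ n) ⟩
  suc n ℕ.% suc n              ≡⟨ n%n≡0 (suc n) ⟩
  0                            ∎)
  where open ≡-Reasoning

LastRowNegatesFirst : ∀ {n} → Matrix (suc n) → Set
LastRowNegatesFirst {n} M = ∀ (j : Fin n) → M (fromℕ n) (inject₁ j) ≡ - M zero (suc j)

module _ {n : ℕ} (B : Matrix (suc n)) where

  Period1Equations : Set
  Period1Equations = ∀ (i j : Fin (suc n)) → mutate0 B (succMod i) (succMod j) ≡ B i j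

  mutate0-sink : Sink0 B → (i j : Fin n) → mutate0 B (suc i) (suc j) ≡ B (suc i) (suc j)
  mutate0-sink sink i j
    rewrite indNeg-nonpos* (proj₁ (sink (suc i))) (proj₁ (sink (suc j)))
          | ℤ.*-zeroʳ (B (suc i) zero ℤ.* ℤ.+ ∣ B zero (suc j) ∣)
    = ℤ.+-identityʳ _

  period1Equations⇔shifts : ZeroDiagonal B → Sink0 B →
    Period1Equations ⇔ (DiagonallyInvariant B × LastRowNegatesFirst B × LastRowNegatesFirst (flip B))
  period1Equations⇔shifts zd sink = mk⇔ shifts equations
    where
    relabel : ∀ {i j i′ j′} → succMod i ≡ i′ → succMod j ≡ j′ →
              mutate0 B (succMod i) (succMod j) ≡ mutate0 B i′ j′
    relabel = cong₂ (mutate0 B)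

    shifts : Period1Equations → DiagonallyInvariant B × LastRowNegatesFirst B × LastRowNegatesFirst (flip B)
    shifts eqs =
      (λ i j → trans (sym (mutate0-sink sink i j))
                     (trans (sym (relabel (succMod-inject₁ i) (succMod-inject₁ j))) (eqs (inject₁ i) (inject₁ j))))
      , (λ j → trans (sym (eqs _ _)) (relabel (succMod-fromℕ n) (succMod-inject₁ j)))
      , (λ i → trans (sym (eqs _ _)) (relabel (succMod-inject₁ i) (succMod-fromℕ n)))

    equations : DiagonallyInvariant B × LastRowNegatesFirst B × LastRowNegatesFirst (flip B) → Period1Equations
    equations (inv , lastRow , lastCol) i j = cases (view i) (view j)
      where
      cases : ∀ {i j} → View i → View j → mutate0 B (succMod i) (succMod j) ≡ B i j
      cases ‵fromℕ ‵fromℕ =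
        trans (relabel (succMod-fromℕ n) (succMod-fromℕ n)) (trans (cong -_ (zd zero)) (sym (zd (fromℕ n))))
      cases ‵fromℕ (‵inj₁ {i = j} _) = trans (relabel (succMod-fromℕ n) (succMod-inject₁ j)) (sym (lastRow j))
      cases (‵inj₁ {i = i} _) ‵fromℕ = trans (relabel (succMod-inject₁ i) (succMod-fromℕ n)) (sym (lastCol i))
      cases (‵inj₁ {i = i} _) (‵inj₁ {i = j} _) =
        trans (relabel (succMod-inject₁ i) (succMod-inject₁ j)) (trans (mutate0-sink sink i j) (inv i j))

neg-swap : ∀ {x y : ℤ} → x ≡ - y → y ≡ - x
neg-swap {x} {y} e = trans (sym (ℤ.neg-involutive y)) (cong -_ (sym e))

via-inject₁ : ∀ {n} (P : ℕ → ℕ → Set) {i j : Fin n} → P (toℕ i) (toℕ j) → P (toℕ (inject₁ i)) (toℕ (inject₁ j))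
via-inject₁ P {i} {j} = subst₂ P (sym (toℕ-inject₁ i)) (sym (toℕ-inject₁ j))

record SkewCirculant {n} (B : Matrix (suc n)) : Set where
  field
    upper : UpperToeplitz B
    lower : ∀ {i j k} → toℕ i + toℕ k ≡ suc n + toℕ j → B i j ≡ - B zero k

module _ {n : ℕ} {B : Matrix (suc n)} where
  open SkewCirculant

  skewCirculant-firstColumn : SkewCirculant B → ∀ {i k} → toℕ i + toℕ k ≡ suc n → B i zero ≡ - B zero k
  skewCirculant-firstColumn sc e = lower sc (trans e (sym (+-identityʳ (suc n))))

  shifts⇒skewCirculant : DiagonallyInvariant B → LastRowNegatesFirst (flip B) → SkewCirculant B
  shifts⇒skewCirculant inv lastCol = record { upper = upperToeplitz ; lower = lowerSkew }
    where
    upperToeplitz : UpperToeplitz B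
    upperToeplitz = diagonallyInvariant⇒upperToeplitz {M = B} inv

    firstColumn : ∀ {i k} → toℕ i + toℕ k ≡ suc n → B i zero ≡ - B zero k
    firstColumn {zero}  {k} e = ⊥-elim (<-irrefl e (toℕ<n k))
    firstColumn {suc i} {k} e = trans (neg-swap (lastCol i)) (cong -_ (upperToeplitz
      (trans (cong (_+ toℕ k) (toℕ-inject₁ i)) (trans (suc-injective e) (sym (toℕ-fromℕ n))))))

    lowerToeplitz : UpperToeplitz (flip B)
    lowerToeplitz = diagonallyInvariant⇒upperToeplitz {M = flip B} (diagonallyInvariant-flip {M = B} inv)

    lowerSkew : ∀ {i j k} → toℕ i + toℕ k ≡ suc n + toℕ j → B i j ≡ - B zero k
    lowerSkew {i} {j} {k} e with difference (<⇒≤ (+≡+⇒> e (toℕ<n k))) (toℕ<n i)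
    ... | d , j+d≡i = trans (lowerToeplitz j+d≡i) (firstColumn (+-cancelˡ-≡ (toℕ j) _ _ (begin
      toℕ j + (toℕ d + toℕ k)  ≡⟨ sym (+-assoc (toℕ j) _ _) ⟩
      toℕ j + toℕ d + toℕ k    ≡⟨ cong (_+ toℕ k) j+d≡i ⟩
      toℕ i + toℕ k            ≡⟨ e ⟩
      suc n + toℕ j            ≡⟨ +-comm (suc n) (toℕ j) ⟩
      toℕ j + suc n            ∎)))
      where open ≡-Reasoning

  skewCirculant⇒shifts : SkewCirculant B →
    DiagonallyInvariant B × LastRowNegatesFirst B × LastRowNegatesFirst (flip B)
  skewCirculant⇒shifts sc = invariant , lastRow , lastCol
    where
    invariant : DiagonallyInvariant B
    invariant i j with toℕ i ≤? toℕ j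
    ... | yes i≤j = let (k , e) = difference i≤j (m<n⇒m<1+n (toℕ<n j)) in
      trans (upper sc (cong suc e)) (sym (upper sc (via-inject₁ (λ a b → a + toℕ k ≡ b) e)))
    ... | no i≰j = let (k , e) = wrappedDifference (≰⇒> i≰j) (<⇒≤ (m<n⇒m<1+n (toℕ<n i))) in
      trans (lower sc (trans (cong suc e) (sym (+-suc (suc n) (toℕ j)))))
            (sym (lower sc (via-inject₁ (λ a b → a + toℕ k ≡ suc n + b) e)))

    lastRow : LastRowNegatesFirst B
    lastRow j = lower sc (trans (cong (_+ suc (toℕ j)) (toℕ-fromℕ n))
                         (trans (+-suc n (toℕ j)) (cong (suc n +_) (sym (toℕ-inject₁ j)))))

    lastCol : LastRowNegatesFirst (flip B)
    lastCol i = let (k , e) = difference (toℕ≤n i) (n<1+n n) in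
      trans (upper sc (trans (cong (_+ toℕ k) (toℕ-inject₁ i)) (trans e (sym (toℕ-fromℕ n)))))
            (neg-swap (skewCirculant-firstColumn sc (cong suc e)))

period1Equations⇔skewCirculant : ∀ {n} {B : Matrix (suc n)} → ZeroDiagonal B → Sink0 B →
  Period1Equations B ⇔ SkewCirculant B
period1Equations⇔skewCirculant {B = B} zd sink = mk⇔
  -- The last-row equations are implied by the others.
  (λ eqs → let (inv , _ , lastCol) = to shifts eqs in shifts⇒skewCirculant inv lastCol)
  (λ sc → from shifts (skewCirculant⇒shifts sc))
  where
  shifts : Period1Equations B ⇔ (DiagonallyInvariant B × LastRowNegatesFirst B × LastRowNegatesFirst (flip B))
  shifts = period1Equations⇔shifts B zd sink

module _ {n : ℕ} (B : Matrix (suc n)) where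

  PairedSigns : Set
  PairedSigns = (i k : Fin (suc n)) → 0 ℕ.< toℕ i → toℕ k ≡ suc n ∸ toℕ i →
    ((B zero i Data.Integer.< 0ℤ) × (B zero k Data.Integer.< 0ℤ)) ⊎ ((B zero i ≡ 0ℤ) × (B zero k ≡ 0ℤ))

  FirstColumnReflectsRow : Set
  FirstColumnReflectsRow = (i k : Fin (suc n)) → 0 ℕ.< toℕ i → toℕ k ≡ suc n ∸ toℕ i →
    B i zero ≡ - B zero k

  UpperFromFirstRow : Set
  UpperFromFirstRow = (i j k : Fin (suc n)) → 0 ℕ.< toℕ i → toℕ i ℕ.< toℕ j →
    toℕ k ≡ toℕ j ∸ toℕ i → B i j ≡ B zero k

  LowerFromFirstRow : Set
  LowerFromFirstRow = (i j k : Fin (suc n)) → 0 ℕ.< toℕ j → toℕ j ℕ.< toℕ i →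
    toℕ k ≡ suc n ∸ toℕ i ℕ.+ toℕ j → B i j ≡ - B zero k

module _ {n : ℕ} {B : Matrix (suc n)} where
  open SkewCirculant

  skewCirculant⇔conditions : ZeroDiagonal B →
    SkewCirculant B ⇔ (FirstColumnReflectsRow B × UpperFromFirstRow B × LowerFromFirstRow B)
  skewCirculant⇔conditions zd = mk⇔ conditions skewCirculant
    where
    conditions : SkewCirculant B → FirstColumnReflectsRow B × UpperFromFirstRow B × LowerFromFirstRow B
    conditions sc =
        (λ i k _ e → skewCirculant-firstColumn sc (≡∸⇒+≡ (toℕ≤n i) e))
      , (λ i j k _ i<j e → upper sc (≡∸⇒+≡ (<⇒≤ i<j) e))
      , (λ i j k _ _ e → lower sc (≡∸+⇒+≡+ (toℕ≤n i) e))

    skewCirculant : FirstColumnReflectsRow B × UpperFromFirstRow B × LowerFromFirstRow B → SkewCirculant B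
    skewCirculant (reflects , above , below) = record { upper = upperToeplitz ; lower = lowerSkew }
      where
      upperToeplitz : UpperToeplitz B
      upperToeplitz {zero}          e = cong (B zero) (toℕ-injective (sym e))
      upperToeplitz {suc i} {j} {zero} e =
        trans (cong (B (suc i)) (toℕ-injective (trans (sym e) (+-identityʳ _)))) (trans (zd (suc i)) (sym (zd zero)))
      upperToeplitz {suc i} {j} {suc k} e =
        above (suc i) j (suc k) z<s (subst (toℕ (suc i) <_) e (m<m+n _ z<s))
          (sym (trans (cong (_∸ toℕ (suc i)) (sym e)) (m+n∸m≡n (toℕ (suc i)) _)))

      lowerSkew : ∀ {i j k} → toℕ i + toℕ k ≡ suc n + toℕ j → B i j ≡ - B zero k
      lowerSkew {i} {zero}  {k} e =
        reflects i k (+≡+⇒> e (toℕ<n k)) (trans (+≡+⇒≡∸+ (toℕ≤n i) e) (+-identityʳ _))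
      lowerSkew {i} {suc j} {k} e = below i (suc j) k z<s (+≡+⇒> e (toℕ<n k)) (+≡+⇒≡∸+ (toℕ≤n i) e)

  mutable⇔pairedSigns : ZeroDiagonal B → Sink0 B → SkewCirculant B → Mutable0 B ⇔ PairedSigns B
  mutable⇔pairedSigns zd sink sc = mk⇔ pairedSigns mutable
    where
    reflects : ∀ {i k} → toℕ i + toℕ k ≡ suc n → B i zero ≡ - B zero k
    reflects = skewCirculant-firstColumn sc

    nonzero-transfer : Mutable0 B → ∀ {i k} → toℕ i + toℕ k ≡ suc n → ¬ B zero k ≡ 0ℤ → ¬ B zero i ≡ 0ℤ
    nonzero-transfer mut {i} e k≢0 = mut i (λ i0 → k≢0 (ℤ.neg-injective {j = 0ℤ} (trans (sym (reflects e)) i0)))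

    pairedSigns : Mutable0 B → PairedSigns B
    pairedSigns mut i k _ e with B zero i ℤ.≟ 0ℤ | B zero k ℤ.≟ 0ℤ | ≡∸⇒+≡ (toℕ≤n i) e
    ... | yes i0  | yes k0  | _   = inj₂ (i0 , k0)
    ... | no i≢0 | no k≢0 | _   = inj₁ (ℤ.≤∧≢⇒< (proj₁ (sink i)) i≢0 , ℤ.≤∧≢⇒< (proj₁ (sink k)) k≢0)
    ... | yes i0  | no k≢0 | i+k = ⊥-elim (nonzero-transfer mut i+k k≢0 i0)
    ... | no i≢0 | yes k0  | i+k = ⊥-elim (nonzero-transfer mut (trans (+-comm (toℕ k) (toℕ i)) i+k) i≢0 k0)

    mutable : PairedSigns B → Mutable0 B
    mutable _  zero    b≢0 _  = b≢0 (zd zero)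
    mutable ps (suc j) b≢0 b0 with wrappedDifference {b = 0} z<s (toℕ≤n (suc j))
    ... | k , e with ps (suc j) k z<s (trans (+≡+⇒≡∸+ (toℕ≤n (suc j)) e) (+-identityʳ _))
    ...   | inj₁ (b<0 , _) = ℤ.<⇒≢ b<0 b0
    ...   | inj₂ (_ , k0)  = b≢0 (trans (reflects (trans e (+-identityʳ _))) (cong -_ k0))

mainTheorem6 : (m : ℕ) → (B : Matrix (suc (suc m))) → ZeroDiagonal B → Sink0 B →
    Period1 B ⇔
      (((i k : Fin (suc (suc m))) → 0 ℕ.< toℕ i → toℕ k ≡ suc (suc m) ∸ toℕ i →
          ((B zero i Data.Integer.< 0ℤ) × (B zero k Data.Integer.< 0ℤ))
            ⊎ ((B zero i ≡ 0ℤ) × (B zero k ≡ 0ℤ)))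
      × ((i k : Fin (suc (suc m))) → 0 ℕ.< toℕ i → toℕ k ≡ suc (suc m) ∸ toℕ i →
          B i zero ≡ - B zero k)
      × ((i j k : Fin (suc (suc m))) → 0 ℕ.< toℕ i → toℕ i ℕ.< toℕ j →
          toℕ k ≡ toℕ j ∸ toℕ i → B i j ≡ B zero k)
      × ((i j k : Fin (suc (suc m))) → 0 ℕ.< toℕ j → toℕ j ℕ.< toℕ i →
          toℕ k ≡ suc (suc m) ∸ toℕ i ℕ.+ toℕ j → B i j ≡ - B zero k))
mainTheorem6 m B zd sink = mk⇔
  (λ (mutable , equations) →
    let sc = to (period1Equations⇔skewCirculant zd sink) equations
    in  to (mutable⇔pairedSigns zd sink sc) mutable , to (skewCirculant⇔conditions zd) sc)
  (λ (pairedSigns , conditions) →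
    let sc = from (skewCirculant⇔conditions zd) conditions
    in  from (mutable⇔pairedSigns zd sink sc) pairedSigns , from (period1Equations⇔skewCirculant zd sink) sc)
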